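{- Let $G$ be a tree rooted at $r$, let $u\ne r$ be a vertex, and let $\sigma$ be a configuration with $\sigma_v<\deg(v)$ for all $v\in\mathrm{subtree}(u)$. Then for every integer $k\ge 0$, $\delta(u,k)\le\delta(u,k+1)\le\delta(u,k)+1$.
   Context: Sandpile on a tree: $\sigma\in\mathbb{N}^{V(G)}$ gives chip counts; vertex $v$ is full if $\sigma_v\ge\deg(v)$; firing $v$ decreases $\sigma_v$ by $\deg(v)$ and adds one chip to each neighbor. $\mathrm{subtree}(u)$ is the vertex set of the subtree rooted at $u$ (including $u$), $\mathrm{parent}(u)$ its parent. For a configuration $\tau$, $\mathrm{final}(\tau,u)$ is the configuration obtained by repeatedly firing full vertices of $\mathrm{subtree}(u)$ (only) until no vertex of $\mathrm{subtree}(u)$ is full; this is well defined and independent of firing order. For $\sigma$ as in the claim and integer $x\ge0$, $\delta(u,x)=\mathrm{final}(\sigma+x e_u,u)_{\mathrm{parent}(u)}-\mathrm{final}(\sigma,u)_{\mathrm{parent}(u)}$, where $e_u$ is the indicator vector of $u$; i.e., the number of chips returned to the parent after adding $x$ chips to $u$ and stabilizing $\mathrm{subtree}(u)$. -}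

module Defs where

open import Data.Nat using (ℕ; zero; suc; _+_; _∸_; _≤_; _<_)
open import Data.Fin using (Fin; zero; suc; toℕ; _≟_)
open import Data.List using (List; length; filter; allFin)
open import Data.Integer using (ℤ; +_; _-_)
open import Data.Product using (Σ; _×_; _,_)
open import Data.Sum using (_⊎_)
open import Relation.Nullary using (yes; no)
open import Relation.Nullary.Decidable using (⌊_⌋)
open import Relation.Binary.PropositionalEquality using (_≡_)
open import Data.Bool using (if_then_else_)

-- A finite rooted tree with vertex set Fin (suc n) and root zero.
-- Every non-root vertex  suc i  has parent  par i,  and vertices are labelled so that
-- parents have smaller labels (e.g. BFS order); every finite rooted tree admits such a labelling.
record RootedTree (n : ℕ) : Set where
  field
    par    : Fin n → Fin (suc n)
    par-lt : ∀ i → toℕ (par i) ≤ toℕ i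

module _ {n : ℕ} (T : RootedTree n) where
  open RootedTree T

  V : Set
  V = Fin (suc n)

  root : V
  root = zero

  Config : Set
  Config = V → ℕ

  parent : Fin n → V
  parent i = par i

  nChildren : V → ℕ
  nChildren v = length (filter (λ i → par i ≟ v) (allFin n))

  deg : V → ℕ
  deg zero    = nChildren zero
  deg (suc i) = suc (nChildren (suc i))

  isNbr : V → V → Data.Bool.Bool
  isNbr v w = isChild w v Data.Bool.∨ isChild v w
    where
    isChild : V → V → Data.Bool.Bool
    isChild zero    p = Data.Bool.false
    isChild (suc i) p = ⌊ par i ≟ p ⌋

  fire : Config → V → Config
  fire τ v w with w ≟ v
  ... | yes _ = τ w ∸ deg v
  ... | no  _ = if isNbr v w then suc (τ w) else τ w

  -- u ≼ v : v ∈ subtree(u)  (u is an ancestor of v or equal to it)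
  data _≼_ (u : V) : V → Set where
    here : u ≼ u
    step : ∀ i → u ≼ par i → u ≼ suc i

  Full : Config → V → Set
  Full τ v = deg v ≤ τ v

  data Reach (u : V) : Config → Config → Set where
    done : ∀ {τ} → Reach u τ τ
    fireStep : ∀ {τ τ'} v → u ≼ v → Full τ v → Reach u (fire τ v) τ' → Reach u τ τ'

  StableOn : V → Config → Set
  StableOn u τ = ∀ v → u ≼ v → τ v < deg v

  IsFinal : V → Config → Config → Set
  IsFinal u τ ρ = Reach u τ ρ × StableOn u ρ

  addAt : Config → V → ℕ → Config
  addAt τ u x w with w ≟ u
  ... | yes _ = τ w + x
  ... | no  _ = τ w

  -- δ(u,x) computed from ρ₀ = final(σ,u) and ρₓ = final(σ + x e_u, u), u = suc i
  δ : Fin n → Config → Config → ℤ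
  δ i ρ₀ ρₓ = + ρₓ (parent i) - + ρ₀ (parent i)

{-# OPTIONS --safe #-}
-- Record a sequence of firings by its firing vector c (c x = number of times x fires); its
-- result is τ + c·L, where the row L v is the change caused by one firing of v. Least action:
-- if β ≥ 0 and τ + β·L is stable on subtree(u), then c ≤ β, because the first vertex to fire
-- is full, hence must occur in β, and can be peeled off. Since u is the only vertex of
-- subtree(u) adjacent to p = parent(u), δ(u,k) = cₖ(u) − c₀(u) for firing vectors cₖ
-- stabilising σ + k eᵤ. Least action with β = cₖ₊₁ gives cₖ ≤ cₖ₊₁. With β = cₖ + 1 − eₚ it
-- gives cₖ₊₁(u) ≤ cₖ(u) + 1: firing every vertex once changes nothing (every vertex has deg
-- neighbours), and on subtree(u) the row L p is eᵤ, which absorbs the extra chip at u.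
module Submission where

open import Data.Bool using (Bool; true; false; _∨_)
open import Data.Bool.Properties using (∨-comm)
open import Data.Empty using (⊥-elim)
open import Data.Fin using (Fin; zero; suc; toℕ; punchIn; _≟_)
open import Data.Fin.Properties using (punchInᵢ≢i)
open import Data.Integer as ℤ
  using (ℤ; +_; _+_; _-_; -_; _*_; 0ℤ; 1ℤ; _≤_; +≤+; +<+)
  renaming (_≟_ to _≟ℤ_)
open import Data.Integer.Properties
  using ( +-identityˡ; +-identityʳ; +-assoc; +-inverseˡ; +-mono-≤; +-monoˡ-≤; +-monoʳ-≤
        ; *-identityˡ; *-identityʳ; *-zeroʳ; *-comm; *-distribʳ-+
        ; +-comm; ≤-refl; ≤-trans; ≤-<-trans; <⇒≱; ≤∧≢⇒<; i<j⇒suc[i]≤j; i≤j⇒0≤j-i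
        ; m-n≡m⊖n; ⊖-≥; +-*-semiring )
open import Data.Integer.Tactic.RingSolver using (solve-∀)
open import Data.List using (length; filter; tabulate)
open import Data.Nat as ℕ using (ℕ; zero; suc; z≤n; s≤s; _<_)
import Data.Nat.Properties as ℕ
open import Data.Product using (_×_; _,_)
open import Function using (_∘_; id)
open import Relation.Binary.PropositionalEquality
open import Relation.Nullary using (¬_; yes; no)
open import Relation.Nullary.Decidable using (⌊_⌋)
open import Relation.Unary using (Pred; Decidable)

open import Algebra.Properties.Semiring.Sum +-*-semiring
  using (sum; sum-cong-≗; ∑-distrib-+; sum-remove; sum-replicate-zero)
open import Defs

sum-nonneg : ∀ {m} (f : Fin m → ℤ) → (∀ x → 0ℤ ≤ f x) → 0ℤ ≤ sum f
sum-nonneg {zero}  f f≥0 = ≤-refl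
sum-nonneg {suc m} f f≥0 = +-mono-≤ (f≥0 zero) (sum-nonneg (f ∘ suc) (f≥0 ∘ suc))

sum-single : ∀ {m} (f : Fin (suc m) → ℤ) v → (∀ x → x ≢ v → f x ≡ 0ℤ) → sum f ≡ f v
sum-single {m} f v f≡0 = begin
  sum f                          ≡⟨ sum-remove f ⟩
  f v + sum (f ∘ punchIn v)
    ≡⟨ cong (λ t → f v + t) (sum-cong-≗ (λ j → f≡0 _ (punchInᵢ≢i v j))) ⟩
  f v + sum {m} (λ _ → 0ℤ)       ≡⟨ cong (λ t → f v + t) (sum-replicate-zero m) ⟩
  f v + 0ℤ                       ≡⟨ +-identityʳ (f v) ⟩
  f v                            ∎
  where open ≡-Reasoning

i+[j-i]≡j : ∀ i j → i + (j - i) ≡ j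
i+[j-i]≡j = solve-∀

[k+i]-[k+j]≡i-j : ∀ k i j → (k + i) - (k + j) ≡ i - j
[k+i]-[k+j]≡i-j = solve-∀

[i+j]-k≡[i-k]+j : ∀ i j k → (i + j) - k ≡ (i - k) + j
[i+j]-k≡[i-k]+j = solve-∀

toℤ : Bool → ℤ
toℤ true  = 1ℤ
toℤ false = 0ℤ

toℤ-nonneg : ∀ b → 0ℤ ≤ toℤ b
toℤ-nonneg true  = +≤+ z≤n
toℤ-nonneg false = +≤+ z≤n

toℤ≤1 : ∀ b → toℤ b ≤ 1ℤ
toℤ≤1 true  = +≤+ (s≤s z≤n)
toℤ≤1 false = +≤+ z≤n

toℤ-∨ : ∀ a b → (a ≡ true → b ≡ false) → toℤ (a ∨ b) ≡ toℤ a + toℤ b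
toℤ-∨ true  true  excl with () ← excl refl
toℤ-∨ true  false _ = refl
toℤ-∨ false b     _ = sym (+-identityˡ (toℤ b))

length-filter-tabulate : ∀ {a p} {A : Set a} {P : Pred A p} (P? : Decidable P) {m} (f : Fin m → A)
  → + length (filter P? (tabulate f)) ≡ sum (λ k → toℤ ⌊ P? (f k) ⌋)
length-filter-tabulate P? {zero}  f = refl
length-filter-tabulate P? {suc m} f with P? (f zero)
... | yes _ = cong (λ t → 1ℤ + t) (length-filter-tabulate P? (f ∘ suc))
... | no _  = trans (length-filter-tabulate P? (f ∘ suc)) (sym (+-identityˡ _))

e : ∀ {m} → Fin m → Fin m → ℤ
e v x = toℤ ⌊ x ≟ v ⌋

⌊≟⌋-refl : ∀ {m} (v : Fin m) → ⌊ v ≟ v ⌋ ≡ true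
⌊≟⌋-refl v with v ≟ v
... | yes _   = refl
... | no v≢v = ⊥-elim (v≢v refl)

⌊≟⌋-off : ∀ {m} {v x : Fin m} → v ≢ x → ⌊ v ≟ x ⌋ ≡ false
⌊≟⌋-off {v = v} {x} v≢x with v ≟ x
... | yes v≡x = ⊥-elim (v≢x v≡x)
... | no _    = refl

e-diag : ∀ {m} (v : Fin m) → e v v ≡ 1ℤ
e-diag v = cong toℤ (⌊≟⌋-refl v)

e-off : ∀ {m} {v x : Fin m} → x ≢ v → e v x ≡ 0ℤ
e-off x≢v = cong toℤ (⌊≟⌋-off x≢v)

sum-e* : ∀ {m} (v : Fin (suc m)) (f : Fin (suc m) → ℤ) → sum (λ x → e v x * f x) ≡ f v
sum-e* v f = trans (sum-single _ v (λ x x≢v → cong (_* f x) (e-off x≢v)))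
                   (trans (cong (_* f v) (e-diag v)) (*-identityˡ (f v)))

module _ {n : ℕ} (T : RootedTree n) where
  open RootedTree T

  isChild : V T → V T → Bool
  isChild zero    _ = false
  isChild (suc j) p = ⌊ par j ≟ p ⌋

  isNbr-isChild : ∀ v w → isNbr T v w ≡ isChild w v ∨ isChild v w
  isNbr-isChild zero    zero    = refl
  isNbr-isChild zero    (suc _) = refl
  isNbr-isChild (suc _) zero    = refl
  isNbr-isChild (suc _) (suc _) = refl

  isNbr-sym : ∀ v w → isNbr T v w ≡ isNbr T w v
  isNbr-sym v w rewrite isNbr-isChild v w | isNbr-isChild w v = ∨-comm (isChild w v) (isChild v w)

  par<suc : ∀ j → toℕ (par j) < toℕ (suc j)
  par<suc j = s≤s (par-lt j)

  isChild⇒< : ∀ c p → isChild c p ≡ true → toℕ p < toℕ c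
  isChild⇒< (suc j) p c→p with par j ≟ p
  isChild⇒< (suc j) p _  | yes refl = par<suc j
  isChild⇒< (suc j) p () | no _

  isChild-irrefl : ∀ w → isChild w w ≡ false
  isChild-irrefl w with isChild w w in w→w
  ... | true  = ⊥-elim (ℕ.<-irrefl refl (isChild⇒< w w w→w))
  ... | false = refl

  isChild-asym : ∀ c p → isChild c p ≡ true → isChild p c ≡ false
  isChild-asym c p c→p with isChild p c in p→c
  ... | true  = ⊥-elim (ℕ.<-asym (isChild⇒< c p c→p) (isChild⇒< p c p→c))
  ... | false = refl

  isNbr-irrefl : ∀ w → isNbr T w w ≡ false
  isNbr-irrefl w rewrite isNbr-isChild w w | isChild-irrefl w = refl

  toℤ-isNbr : ∀ x w → toℤ (isNbr T x w) ≡ toℤ (isChild w x) + toℤ (isChild x w)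
  toℤ-isNbr x w rewrite isNbr-isChild x w = toℤ-∨ (isChild w x) (isChild x w) (isChild-asym w x)

  sum-isChild-parents : ∀ w → sum (λ x → toℤ (isChild w x)) + + nChildren T w ≡ + deg T w
  sum-isChild-parents zero    = cong (_+ + nChildren T zero) (sum-replicate-zero (suc n))
  sum-isChild-parents (suc j) = cong (_+ + nChildren T (suc j))
    (trans (sum-single _ (par j) (λ x x≢pj → cong toℤ (⌊≟⌋-off (x≢pj ∘ sym)))) (e-diag (par j)))

  sum-isChild-children : ∀ w → sum (λ x → toℤ (isChild x w)) ≡ + nChildren T w
  sum-isChild-children w =
    trans (+-identityˡ _) (sym (length-filter-tabulate (λ j → par j ≟ w) id))

  sum-isNbr : ∀ w → sum (λ x → toℤ (isNbr T x w)) ≡ + deg T w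
  sum-isNbr w = begin
    sum (λ x → toℤ (isNbr T x w))  ≡⟨ sum-cong-≗ (λ x → toℤ-isNbr x w) ⟩
    sum (λ x → up x + down x)      ≡⟨ ∑-distrib-+ up down ⟩
    sum up + sum down              ≡⟨ cong (λ t → sum up + t) (sum-isChild-children w) ⟩
    sum up + + nChildren T w       ≡⟨ sum-isChild-parents w ⟩
    + deg T w                      ∎
    where
    open ≡-Reasoning
    up down : V T → ℤ
    up   x = toℤ (isChild w x)
    down x = toℤ (isChild x w)

  -- L v w is the change at w when v fires, i.e. minus the graph Laplacian.
  L : V T → V T → ℤ
  L v w with w ≟ v
  ... | yes _ = - + deg T v
  ... | no  _ = toℤ (isNbr T v w)

  fire-L : ∀ τ v → Full T τ v → ∀ w → + fire T τ v w ≡ + τ w + L v w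
  fire-L τ v full w with w ≟ v
  ... | yes refl = trans (sym (⊖-≥ full)) (sym (m-n≡m⊖n (τ w) (deg T w)))
  ... | no  _ with isNbr T v w
  ...   | true  = +-comm 1ℤ (+ τ w)
  ...   | false = sym (+-identityʳ (+ τ w))

  L-diag : ∀ w → L w w ≡ - + deg T w
  L-diag w with w ≟ w
  ... | yes _   = refl
  ... | no w≢w = ⊥-elim (w≢w refl)

  L-off : ∀ {x w} → x ≢ w → L x w ≡ toℤ (isNbr T x w)
  L-off {x} {w} x≢w with w ≟ x
  ... | yes w≡x = ⊥-elim (x≢w (sym w≡x))
  ... | no _    = refl

  L-sym : ∀ x w → L x w ≡ L w x
  L-sym x w with w ≟ x | x ≟ w
  ... | yes refl | yes _    = refl
  ... | yes refl | no x≢x   = ⊥-elim (x≢x refl)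
  ... | no w≢w   | yes refl = ⊥-elim (w≢w refl)
  ... | no _     | no _     = cong toℤ (isNbr-sym x w)

  L-column-sum : ∀ w → sum (λ x → L x w) ≡ 0ℤ
  L-column-sum w = begin
    sum (λ x → L x w)                  ≡⟨ sum-remove (λ x → L x w) ⟩
    L w w + sum (λ j → L (punchIn w j) w)
      ≡⟨ cong₂ _+_ (L-diag w) (sum-cong-≗ (λ j → L-off (punchInᵢ≢i w j))) ⟩
    - + deg T w + offDiagonal          ≡⟨ cong (λ t → - + deg T w + t) degree ⟩
    - + deg T w + + deg T w            ≡⟨ +-inverseˡ (+ deg T w) ⟩
    0ℤ                                 ∎
    where
    open ≡-Reasoning
    offDiagonal : ℤ
    offDiagonal = sum (λ j → toℤ (isNbr T (punchIn w j) w))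
    degree : offDiagonal ≡ + deg T w
    degree = begin
      offDiagonal                      ≡⟨ sym (+-identityˡ offDiagonal) ⟩
      toℤ false + offDiagonal          ≡⟨ cong (λ b → toℤ b + offDiagonal) (isNbr-irrefl w) ⟨
      toℤ (isNbr T w w) + offDiagonal  ≡⟨ sum-remove (λ x → toℤ (isNbr T x w)) ⟨
      sum (λ x → toℤ (isNbr T x w))    ≡⟨ sum-isNbr w ⟩
      + deg T w                        ∎

  Lap : (V T → ℤ) → V T → ℤ
  Lap β w = sum (λ x → β x * L x w)

  Lap-cong : ∀ {β γ} → (∀ x → β x ≡ γ x) → ∀ w → Lap β w ≡ Lap γ w
  Lap-cong β≡γ w = sum-cong-≗ (λ x → cong (_* L x w) (β≡γ x))

  Lap-+ : ∀ β γ w → Lap (λ x → β x + γ x) w ≡ Lap β w + Lap γ w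
  Lap-+ β γ w = trans (sum-cong-≗ (λ x → *-distribʳ-+ (L x w) (β x) (γ x)))
                      (∑-distrib-+ (λ x → β x * L x w) (λ x → γ x * L x w))

  Lap-0 : ∀ w → Lap (λ _ → 0ℤ) w ≡ 0ℤ
  Lap-0 w = sum-replicate-zero (suc n)

  Lap-1 : ∀ w → Lap (λ _ → 1ℤ) w ≡ 0ℤ
  Lap-1 w = trans (sum-cong-≗ (λ x → *-identityˡ (L x w))) (L-column-sum w)

  Lap-e+ : ∀ v β w → Lap (λ x → e v x + β x) w ≡ L v w + Lap β w
  Lap-e+ v β w = trans (Lap-+ (e v) β w) (cong (_+ Lap β w) (sum-e* v (λ x → L x w)))

  Lap-nonneg : ∀ β v → (∀ x → 0ℤ ≤ β x) → β v ≡ 0ℤ → 0ℤ ≤ Lap β v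
  Lap-nonneg β v β≥0 βv≡0 = sum-nonneg _ term-nonneg
    where
    term-nonneg : ∀ x → 0ℤ ≤ β x * L x v
    term-nonneg x with x ≟ v
    ... | yes refl rewrite βv≡0 = ≤-refl
    ... | no x≢v rewrite L-off x≢v with isNbr T x v
    ...   | true  = subst (0ℤ ≤_) (sym (*-identityʳ (β x))) (β≥0 x)
    ...   | false = subst (0ℤ ≤_) (sym (*-zeroʳ (β x))) ≤-refl

  fireBy : Config T → (V T → ℤ) → V T → ℤ
  fireBy τ β w = + τ w + Lap β w

  fireBy-fire : ∀ τ v β → Full T τ v
    → ∀ w → fireBy (fire T τ v) β w ≡ fireBy τ (λ x → e v x + β x) w
  fireBy-fire τ v β full w = begin
    + fire T τ v w + Lap β w            ≡⟨ cong (_+ Lap β w) (fire-L τ v full w) ⟩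
    (+ τ w + L v w) + Lap β w           ≡⟨ +-assoc (+ τ w) (L v w) (Lap β w) ⟩
    + τ w + (L v w + Lap β w)           ≡⟨ cong (λ t → + τ w + t) (Lap-e+ v β w) ⟨
    + τ w + Lap (λ x → e v x + β x) w   ∎
    where open ≡-Reasoning

  firings : ∀ {u τ ρ} → Reach T u τ ρ → V T → ℤ
  firings done                  _ = 0ℤ
  firings (fireStep v _ _ r) x = e v x + firings r x

  firings-nonneg : ∀ {u τ ρ} (r : Reach T u τ ρ) → ∀ x → 0ℤ ≤ firings r x
  firings-nonneg done               _ = ≤-refl
  firings-nonneg (fireStep v _ _ r) x = +-mono-≤ (toℤ-nonneg ⌊ x ≟ v ⌋) (firings-nonneg r x)

  firings-outside : ∀ {u τ ρ} (r : Reach T u τ ρ) → ∀ x → ¬ _≼_ T u x → firings r x ≡ 0ℤ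
  firings-outside done                 _ _   = refl
  firings-outside (fireStep v u≼v _ r) x u⋠x =
    trans (cong (_+ firings r x) (e-off x≢v)) (trans (+-identityˡ _) (firings-outside r x u⋠x))
    where
    x≢v : x ≢ v
    x≢v refl = u⋠x u≼v

  reach-fireBy : ∀ {u τ ρ} (r : Reach T u τ ρ) → ∀ w → + ρ w ≡ fireBy τ (firings r) w
  reach-fireBy {τ = τ} done w = sym (trans (cong (λ t → + τ w + t) (Lap-0 w)) (+-identityʳ (+ τ w)))
  reach-fireBy {τ = τ} (fireStep v _ full r) w =
    trans (reach-fireBy r w) (fireBy-fire τ v (firings r) full w)

  Stabilizes : V T → Config T → (V T → ℤ) → Set
  Stabilizes u τ β = ∀ w → _≼_ T u w → fireBy τ β w ℤ.< + deg T w

  full⇒fires : ∀ {u τ v} β → (∀ x → 0ℤ ≤ β x) → Stabilizes u τ β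
    → _≼_ T u v → Full T τ v → 1ℤ ≤ β v
  full⇒fires {τ = τ} {v} β β≥0 stable u≼v full with β v ≟ℤ 0ℤ
  ... | no βv≢0 = i<j⇒suc[i]≤j (≤∧≢⇒< (β≥0 v) (βv≢0 ∘ sym))
  ... | yes βv≡0 = ⊥-elim (<⇒≱ (stable v u≼v) (≤-trans (+≤+ full) τv≤))
    where
    τv≤ : + τ v ≤ fireBy τ β v
    τv≤ = subst (_≤ fireBy τ β v) (+-identityʳ (+ τ v))
            (+-monoʳ-≤ (+ τ v) (Lap-nonneg β v β≥0 βv≡0))

  least-action : ∀ {u τ ρ} (r : Reach T u τ ρ) β → (∀ x → 0ℤ ≤ β x) → Stabilizes u τ β
    → ∀ x → firings r x ≤ β x
  least-action done β β≥0 _ x = β≥0 x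
  least-action {u} {τ} (fireStep v u≼v full r) β β≥0 stable x =
    subst (firings (fireStep v u≼v full r) x ≤_) (e+[β-e] x)
      (+-monoʳ-≤ (e v x) (least-action r β′ β′≥0 stable′ x))
    where
    β′ : V T → ℤ
    β′ y = β y - e v y

    e+[β-e] : ∀ y → e v y + β′ y ≡ β y
    e+[β-e] y = i+[j-i]≡j (e v y) (β y)

    β′≥0 : ∀ y → 0ℤ ≤ β′ y
    β′≥0 y = i≤j⇒0≤j-i e≤β
      where
      e≤β : e v y ≤ β y
      e≤β with y ≟ v
      ... | yes refl = full⇒fires β β≥0 stable u≼v full
      ... | no _     = β≥0 y

    stable′ : Stabilizes u (fire T τ v) β′
    stable′ w u≼w = subst (ℤ._< + deg T w) fireBy≡ (stable w u≼w)
      where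
      fireBy≡ : fireBy τ β w ≡ fireBy (fire T τ v) β′ w
      fireBy≡ = sym (trans (fireBy-fire τ v β′ full w)
                           (cong (λ t → + τ w + t) (Lap-cong e+[β-e] w)))

  firings-mono : ∀ {u τ τ′ ρ ρ′} → (∀ w → _≼_ T u w → + τ w ≤ + τ′ w)
    → (r : Reach T u τ ρ) (r′ : Reach T u τ′ ρ′) → StableOn T u ρ′
    → ∀ x → firings r x ≤ firings r′ x
  firings-mono {u} {τ} τ≤τ′ r r′ stable′ =
    least-action r (firings r′) (firings-nonneg r′) stable
    where
    stable : Stabilizes u τ (firings r′)
    stable w u≼w = ≤-<-trans (+-monoˡ-≤ (Lap (firings r′) w) (τ≤τ′ w u≼w))
                     (subst (ℤ._< + deg T w) (reach-fireBy r′ w) (+<+ (stable′ w u≼w)))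

  ≼⇒toℕ≤ : ∀ {u v} → _≼_ T u v → toℕ u ℕ.≤ toℕ v
  ≼⇒toℕ≤ here       = ℕ.≤-refl
  ≼⇒toℕ≤ (step j q) = ℕ.≤-trans (≼⇒toℕ≤ q) (ℕ.<⇒≤ (par<suc j))

  ≼-par : ∀ {u j} → _≼_ T u (suc j) → u ≢ suc j → _≼_ T u (par j)
  ≼-par here       u≢u = ⊥-elim (u≢u refl)
  ≼-par (step _ q) _   = q

  par∉subtree : ∀ i → ¬ _≼_ T (suc i) (par i)
  par∉subtree i u≼p = ℕ.<⇒≱ (par<suc i) (≼⇒toℕ≤ u≼p)

  par≢suc : ∀ i → par i ≢ suc i
  par≢suc i p≡u = par∉subtree i (subst (_≼_ T (suc i)) (sym p≡u) here)

  ≼-child : ∀ {u c x} → _≼_ T u x → isChild c x ≡ true → _≼_ T u c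
  ≼-child {c = suc j} {x} u≼x c→x with par j ≟ x
  ≼-child {c = suc j} u≼x _  | yes refl = step j u≼x
  ≼-child {c = suc j} u≼x () | no _

  isChild-par : ∀ i {x} → _≼_ T (suc i) x → isChild x (par i) ≡ ⌊ x ≟ suc i ⌋
  isChild-par i {suc j} u≼x with suc j ≟ suc i
  ... | yes refl = ⌊≟⌋-refl (par i)
  ... | no x≢u with par j ≟ par i
  ...   | yes pj≡pi = ⊥-elim (par∉subtree i (subst (_≼_ T (suc i)) pj≡pi (≼-par u≼x (x≢u ∘ sym))))
  ...   | no _      = refl

  L-to-par : ∀ i {x} → _≼_ T (suc i) x → L x (par i) ≡ e (suc i) x
  L-to-par i {x} u≼x = begin
    L x (par i)                                   ≡⟨ L-off x≢p ⟩
    toℤ (isNbr T x (par i))                       ≡⟨ toℤ-isNbr x (par i) ⟩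
    toℤ (isChild (par i) x) + toℤ (isChild x (par i))
      ≡⟨ cong₂ (λ a b → toℤ a + toℤ b) p↛x (isChild-par i u≼x) ⟩
    0ℤ + e (suc i) x                              ≡⟨ +-identityˡ (e (suc i) x) ⟩
    e (suc i) x                                   ∎
    where
    open ≡-Reasoning
    x≢p : x ≢ par i
    x≢p refl = par∉subtree i u≼x
    p↛x : isChild (par i) x ≡ false
    p↛x with isChild (par i) x in p→x
    ... | true  = ⊥-elim (par∉subtree i (≼-child u≼x p→x))
    ... | false = refl

  Lap-par : ∀ i β → (∀ x → ¬ _≼_ T (suc i) x → β x ≡ 0ℤ) → Lap β (par i) ≡ β (suc i)
  Lap-par i β β-supported = trans (sum-cong-≗ term) (sum-e* (suc i) β)
    where
    term : ∀ x → β x * L x (par i) ≡ e (suc i) x * β x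
    term x with L x (par i) ≟ℤ e (suc i) x
    ... | yes L≡e = trans (cong (β x *_) L≡e) (*-comm (β x) (e (suc i) x))
    ... | no  L≢e rewrite β-supported x (L≢e ∘ L-to-par i) = sym (*-zeroʳ (e (suc i) x))

  chips-at-par : ∀ i {τ ρ} (r : Reach T (suc i) τ ρ) → + ρ (par i) ≡ + τ (par i) + firings r (suc i)
  chips-at-par i {τ} r = trans (reach-fireBy r (par i))
    (cong (λ t → + τ (par i) + t) (Lap-par i (firings r) (firings-outside r)))

  firings-add-unit : ∀ i {τ τ′ ρ ρ′} → (∀ w → _≼_ T (suc i) w → + τ′ w ≡ + τ w + e (suc i) w)
    → (r : Reach T (suc i) τ ρ) → StableOn T (suc i) ρ → (r′ : Reach T (suc i) τ′ ρ′)
    → firings r′ (suc i) ≤ firings r (suc i) + 1ℤ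
  firings-add-unit i {τ} {τ′} {ρ} τ′≡τ+e r stable r′ =
    subst (firings r′ (suc i) ≤_) β-at-u (least-action r′ β β≥0 stable′ (suc i))
    where
    c : V T → ℤ
    c = firings r
    β : V T → ℤ
    β x = (c x + 1ℤ) - e (par i) x

    β-at-u : β (suc i) ≡ c (suc i) + 1ℤ
    β-at-u = trans (cong (λ t → (c (suc i) + 1ℤ) - t) (e-off (par≢suc i ∘ sym)))
                (+-identityʳ (c (suc i) + 1ℤ))

    β≥0 : ∀ x → 0ℤ ≤ β x
    β≥0 x = i≤j⇒0≤j-i (≤-trans (toℤ≤1 ⌊ x ≟ par i ⌋)
              (subst (_≤ c x + 1ℤ) (+-identityˡ 1ℤ) (+-monoˡ-≤ 1ℤ (firings-nonneg r x))))

    fireBy≡ : ∀ w → _≼_ T (suc i) w → fireBy τ′ β w ≡ + ρ w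
    fireBy≡ w u≼w = begin
      + τ′ w + Lap β w                          ≡⟨ cong (_+ Lap β w) (τ′≡τ+e w u≼w) ⟩
      (+ τ w + e (suc i) w) + Lap β w           ≡⟨ +-assoc (+ τ w) (e (suc i) w) (Lap β w) ⟩
      + τ w + (e (suc i) w + Lap β w)
        ≡⟨ cong (λ t → + τ w + (t + Lap β w)) (trans (L-sym (par i) w) (L-to-par i u≼w)) ⟨
      + τ w + (L (par i) w + Lap β w)           ≡⟨ cong (λ t → + τ w + t) (Lap-e+ (par i) β w) ⟨
      + τ w + Lap (λ x → e (par i) x + β x) w
        ≡⟨ cong (λ t → + τ w + t) (Lap-cong (λ x → i+[j-i]≡j (e (par i) x) (c x + 1ℤ)) w) ⟩
      + τ w + Lap (λ x → c x + 1ℤ) w            ≡⟨ cong (λ t → + τ w + t) (Lap-+ c (λ _ → 1ℤ) w) ⟩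
      + τ w + (Lap c w + Lap (λ _ → 1ℤ) w)      ≡⟨ cong (λ t → + τ w + (Lap c w + t)) (Lap-1 w) ⟩
      + τ w + (Lap c w + 0ℤ)                    ≡⟨ cong (λ t → + τ w + t) (+-identityʳ (Lap c w)) ⟩
      fireBy τ c w                              ≡⟨ reach-fireBy r w ⟨
      + ρ w                                     ∎
      where open ≡-Reasoning

    stable′ : Stabilizes (suc i) τ′ β
    stable′ w u≼w = subst (ℤ._< + deg T w) (sym (fireBy≡ w u≼w)) (+<+ (stable w u≼w))

  addAt-mono : ∀ σ u {k l} → k ℕ.≤ l → ∀ w → addAt T σ u k w ℕ.≤ addAt T σ u l w
  addAt-mono σ u k≤l w with w ≟ u
  ... | yes _ = ℕ.+-monoʳ-≤ (σ w) k≤l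
  ... | no  _ = ℕ.≤-refl

  addAt-suc : ∀ σ u k w → + addAt T σ u (suc k) w ≡ + addAt T σ u k w + e u w
  addAt-suc σ u k w with w ≟ u
  ... | yes _ = cong +_ (trans (ℕ.+-suc (σ w) k) (ℕ.+-comm 1 (σ w ℕ.+ k)))
  ... | no  _ = sym (+-identityʳ (+ σ w))

  addAt-off : ∀ σ u k {w} → w ≢ u → addAt T σ u k w ≡ σ w
  addAt-off σ u k {w} w≢u with w ≟ u
  ... | yes w≡u = ⊥-elim (w≢u w≡u)
  ... | no  _   = refl

  δ-firings : ∀ i {σ ρ₀ ρ} k
    → (r₀ : Reach T (suc i) σ ρ₀) (r : Reach T (suc i) (addAt T σ (suc i) k) ρ)
    → δ T i ρ₀ ρ ≡ firings r (suc i) - firings r₀ (suc i)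
  δ-firings i {σ} {ρ₀} {ρ} k r₀ r = begin
    + ρ (par i) - + ρ₀ (par i)
      ≡⟨ cong₂ _-_ (chips-at-par i r) (chips-at-par i r₀) ⟩
    (+ addAt T σ (suc i) k (par i) + c) - (+ σ (par i) + c₀)
      ≡⟨ cong (λ s → (+ s + c) - (+ σ (par i) + c₀)) (addAt-off σ (suc i) k (par≢suc i)) ⟩
    (+ σ (par i) + c) - (+ σ (par i) + c₀)
      ≡⟨ [k+i]-[k+j]≡i-j (+ σ (par i)) c c₀ ⟩
    c - c₀ ∎
    where
    open ≡-Reasoning
    c c₀ : ℤ
    c  = firings r (suc i)
    c₀ = firings r₀ (suc i)

  firings-addAt-suc : ∀ i σ k {ρₖ ρₖ₁}
    → (rₖ : Reach T (suc i) (addAt T σ (suc i) k) ρₖ) → StableOn T (suc i) ρₖ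
    → (rₖ₁ : Reach T (suc i) (addAt T σ (suc i) (suc k)) ρₖ₁) → StableOn T (suc i) ρₖ₁
    → firings rₖ (suc i) ≤ firings rₖ₁ (suc i) × firings rₖ₁ (suc i) ≤ firings rₖ (suc i) + 1ℤ
  firings-addAt-suc i σ k rₖ stableₖ rₖ₁ stableₖ₁ =
    firings-mono (λ w _ → +≤+ (addAt-mono σ (suc i) (ℕ.n≤1+n k) w)) rₖ rₖ₁ stableₖ₁ (suc i) ,
    firings-add-unit i (λ w _ → addAt-suc σ (suc i) k w) rₖ stableₖ rₖ₁

lemma3p4 : ∀ {n} (T : RootedTree n) (i : Fin n) (σ : Config T)
    → (∀ v → _≼_ T (suc i) v → σ v < deg T v)
    → ∀ (k : ℕ) (ρ₀ ρₖ ρₖ₁ : Config T)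
    → IsFinal T (suc i) σ ρ₀
    → IsFinal T (suc i) (addAt T σ (suc i) k) ρₖ
    → IsFinal T (suc i) (addAt T σ (suc i) (suc k)) ρₖ₁
    → (δ T i ρ₀ ρₖ ≤ δ T i ρ₀ ρₖ₁) × (δ T i ρ₀ ρₖ₁ ≤ δ T i ρ₀ ρₖ + + 1)
lemma3p4 T i σ _ k ρ₀ ρₖ ρₖ₁ (r₀ , _) (rₖ , stableₖ) (rₖ₁ , stableₖ₁)
  rewrite δ-firings T i k r₀ rₖ | δ-firings T i (suc k) r₀ rₖ₁
  with firings-addAt-suc T i σ k rₖ stableₖ rₖ₁ stableₖ₁
... | cₖ≤cₖ₁ , cₖ₁≤cₖ+1 =
  +-monoˡ-≤ (- c₀) cₖ≤cₖ₁ ,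
  subst (_ ≤_) ([i+j]-k≡[i-k]+j (firings T rₖ (suc i)) 1ℤ c₀) (+-monoˡ-≤ (- c₀) cₖ₁≤cₖ+1)
  where
  c₀ : ℤ
  c₀ = firings T r₀ (suc i)
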